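{- Let $p$ be an odd prime and let $\rho$ be a primitive root modulo $p$. Let $r = \rho(\rho-1)^{ -1} \in \mathbb{Z}_p$. Then the sequence $(0, \rho, \rho^2, \ldots, \rho^{p-1})$ of elements of $\mathbb{Z}_p$ (the primitive root construction) is a Roman pseudoterrace for $\mathbb{Z}_p$ with respect to the automorphism $x \mapsto rx$ of $\mathbb{Z}_p$.
   Context: $\mathbb{Z}_p$ denotes the integers modulo $p$ under addition. For a finite group $G$ (written additively when abelian) with an automorphism $\alpha$, the cycle of $g \in G$ under $\alpha$ is $\bar g = \{\alpha^s(g) : s \ge 1\}$. For an arrangement $\mathbf{a} = (a_1, \ldots, a_t)$ of all elements of $G$ (each exactly once), its difference/quotient triangle has lines $T_1, \ldots, T_{t-1}$, where $T_j = (a_{1+j} - a_1, a_{2+j} - a_2, \ldots, a_t - a_{t-j})$ (in multiplicative notation, $a_i^{ -1}a_{i+j}$). The arrangement $\mathbf{a}$ is a Roman-$k$ pseudoterrace with respect to $\alpha$ if for every non-identity $g \in G$ and every $1 \le j \le k$, the number of entries of $T_j$ lying in $\bar g$ is at most $|\bar g|$. A Roman pseudoterrace is a Roman-$1$ pseudoterrace. -}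

module Defs where

open import Data.Nat using (ℕ; zero; suc; _+_; _*_; _∸_; _^_; _≤_; _<_; NonZero)
open import Data.Nat.Properties using (_≟_)
open import Data.Nat.DivMod using (_%_)
open import Data.List using (List; []; _∷_; map; length; filter; zipWith; drop; upTo)
open import Data.List.Relation.Unary.Any using (Any; any?)
open import Data.List.Relation.Binary.Permutation.Propositional using (_↭_)
open import Relation.Binary.PropositionalEquality using (_≡_)
open import Relation.Nullary using (¬_; Dec)
open import Data.Product using (_×_)

-- The cyclic group ℤ_n is modelled by the naturals 0,…,n-1 with
-- addition/subtraction modulo n.  An automorphism α is given as a
-- function ℕ → ℕ (acting on representatives).

iter : (ℕ → ℕ) → ℕ → ℕ → ℕ
iter α zero    x = x
iter α (suc s) x = α (iter α s x)

-- h lies in the cycle ḡ = {α^s(g) : s ≥ 1}.  Since α is a permutation of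
-- a set of size n, every element of ḡ is α^s(g) for some 1 ≤ s ≤ n, so
-- the search over s is bounded by n (this is an exact description of ḡ).
InCycle : ℕ → (ℕ → ℕ) → ℕ → ℕ → Set
InCycle n α g h = Any (λ s → h ≡ iter α (suc s) g) (upTo n)

inCycle? : (n : ℕ) (α : ℕ → ℕ) (g h : ℕ) → Dec (InCycle n α g h)
inCycle? n α g h = any? (λ s → h ≟ iter α (suc s) g) (upTo n)

cycle : ℕ → (ℕ → ℕ) → ℕ → List ℕ
cycle n α g = filter (inCycle? n α g) (upTo n)

-- subtraction in ℤ_n : x - y (for y ≤ n)
subMod : (n : ℕ) .{{_ : NonZero n}} → ℕ → ℕ → ℕ
subMod n x y = (x + (n ∸ y)) % n

-- line T_j of the difference triangle: (a_{1+j} - a_1, …, a_t - a_{t-j})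
diffLine : (n : ℕ) .{{_ : NonZero n}} → List ℕ → ℕ → List ℕ
diffLine n a j = zipWith (subMod n) (drop j a) a

IsArrangement : ℕ → List ℕ → Set
IsArrangement n a = a ↭ upTo n

RomanKPseudoterrace : (n : ℕ) .{{_ : NonZero n}} → (ℕ → ℕ) → ℕ → List ℕ → Set
RomanKPseudoterrace n α k a =
  IsArrangement n a ×
  (∀ g → g < n → ¬ (g ≡ 0) → ∀ j → 1 ≤ j → j ≤ k →
     length (filter (inCycle? n α g) (diffLine n a j)) ≤ length (cycle n α g))

RomanPseudoterrace : (n : ℕ) .{{_ : NonZero n}} → (ℕ → ℕ) → List ℕ → Set
RomanPseudoterrace n α a = RomanKPseudoterrace n α 1 a

PrimitiveRoot : (p : ℕ) .{{_ : NonZero p}} → ℕ → Set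
PrimitiveRoot p ρ =
  (ρ ^ (p ∸ 1)) % p ≡ 1 % p ×
  (∀ k → 1 ≤ k → k < p ∸ 1 → ¬ ((ρ ^ k) % p ≡ 1 % p))

primRootSeq : (p : ℕ) .{{_ : NonZero p}} → ℕ → List ℕ
primRootSeq p ρ = 0 ∷ map (λ i → (ρ ^ suc i) % p) (upTo (p ∸ 1))

-- The first line of the difference triangle is T₁ = (ρ, (ρ - 1) ρ, (ρ - 1) ρ², …, (ρ - 1) ρ^{p-2}).
-- Its first entry is ρ = r (ρ - 1) = α (ρ - 1), and a cycle of the automorphism α is closed under
-- α⁻¹, so replacing ρ by ρ - 1 cannot decrease the number of entries of T₁ in any cycle ḡ. The new
-- line ((ρ - 1) ρ^i)_{i < p-1} consists of distinct elements of ℤ_p, so at most |ḡ| of them lie in ḡ.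
-- That α is invertible with α^{p-1} = id comes from r being a nonzero residue, hence a power of ρ.
module Submission where

open import Defs
open import Data.Empty using (⊥-elim)
open import Data.List using (List; []; _∷_; _++_; length; filter; zipWith; applyUpTo; upTo)
open import Data.List.Properties using (length-++; ++-identityʳ; map-upTo; length-applyUpTo; length-upTo)
open import Data.List.Membership.Propositional using (_∈_)
open import Data.List.Membership.Propositional.Properties using (∈-∃++; ∈-upTo⁺; ∈-filter⁺; ∈-filter⁻)
open import Data.List.Relation.Unary.All as All using (All)
import Data.List.Relation.Unary.All.Properties as All
open import Data.List.Relation.Unary.Any using (here; there)
open import Data.List.Relation.Unary.Any.Properties using (applyUpTo⁺; applyUpTo⁻)
open import Data.List.Relation.Unary.AllPairs using (_∷_)
open import Data.List.Relation.Unary.Unique.Propositional using (Unique)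
open import Data.List.Relation.Unary.Unique.Propositional.Properties using (applyUpTo⁺₁; filter⁺)
open import Data.List.Relation.Binary.Subset.Propositional using (_⊆_)
open import Data.List.Relation.Binary.Permutation.Propositional using (_↭_; ↭-refl; ↭-sym; ↭-trans; prep)
open import Data.List.Relation.Binary.Permutation.Propositional.Properties using (shift; ∈-resp-↭; ↭-length)
open import Data.Nat using (ℕ; zero; suc; _+_; _*_; _∸_; _^_; _≤_; _<_; z≤n; s≤s; NonZero; ≢-nonZero; nonTrivial⇒n>1)
open import Data.Nat.Properties
open import Data.Nat.DivMod using (_%_; m%n%n≡m%n; %-distribˡ-+; %-distribˡ-*; m<n⇒m%n≡m; m%n<n; [m+n]%n≡m%n)
open import Data.Nat.Primality using (Prime; prime⇒nonTrivial)
open import Data.Product using (∃; _,_; proj₁; proj₂)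
open import Function using (id; _∘_)
open import Relation.Binary.PropositionalEquality
open import Relation.Nullary using (¬_; yes; no)
open import Relation.Unary using (Decidable)
open import Relation.Binary.Bundles using (Setoid)
import Relation.Binary.Reasoning.Setoid as SetoidReasoning
open import Level using (0ℓ)

module _ {A : Set} where

  ∈⇒↭∷ : ∀ {x : A} {ys} → x ∈ ys → ∃ λ zs → ys ↭ x ∷ zs
  ∈⇒↭∷ x∈ys with xs , zs , refl ← ∈-∃++ x∈ys = xs ++ zs , shift _ xs zs

  ∷⊆↭∷⇒⊆ : ∀ {x : A} {xs ys zs} → All (x ≢_) xs → x ∷ xs ⊆ ys → ys ↭ x ∷ zs → xs ⊆ zs
  ∷⊆↭∷⇒⊆ x∉xs x∷xs⊆ys ys↭ y∈xs with ∈-resp-↭ ys↭ (x∷xs⊆ys (there y∈xs))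
  ... | here refl   = ⊥-elim (All.lookup x∉xs y∈xs refl)
  ... | there y∈zs = y∈zs

  Unique-⊆⇒↭++ : ∀ {xs ys : List A} → Unique xs → xs ⊆ ys → ∃ λ zs → ys ↭ xs ++ zs
  Unique-⊆⇒↭++ {[]}     {ys} _             _       = ys , ↭-refl
  Unique-⊆⇒↭++ {x ∷ xs}      (x∉xs ∷ xs!) x∷xs⊆ys
    with ys′ , ys↭ ← ∈⇒↭∷ (x∷xs⊆ys (here refl))
    with zs , ys′↭ ← Unique-⊆⇒↭++ xs! (∷⊆↭∷⇒⊆ x∉xs x∷xs⊆ys ys↭)
    = zs , ↭-trans ys↭ (prep x ys′↭)

  Unique-⊆⇒length≤ : ∀ {xs ys : List A} → Unique xs → xs ⊆ ys → length xs ≤ length ys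
  Unique-⊆⇒length≤ {xs} xs! xs⊆ys with zs , ys↭ ← Unique-⊆⇒↭++ xs! xs⊆ys =
    subst (length xs ≤_) (sym (trans (↭-length ys↭) (length-++ xs))) (m≤m+n _ _)

  Unique-⊆-length≤⇒↭ : ∀ {xs ys : List A} → Unique xs → xs ⊆ ys → length ys ≤ length xs → xs ↭ ys
  Unique-⊆-length≤⇒↭ {xs} {ys} xs! xs⊆ys |ys|≤|xs| with Unique-⊆⇒↭++ xs! xs⊆ys
  ... | []    , ys↭ = ↭-sym (subst (ys ↭_) (++-identityʳ xs) ys↭)
  ... | _ ∷ _ , ys↭ =
    ⊥-elim (m+1+n≰m (length xs) (subst (_≤ length xs) (trans (↭-length ys↭) (length-++ xs)) |ys|≤|xs|))

module _ {A : Set} {P : A → Set} (P? : Decidable P) where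

  length-filter-∷-mono : ∀ {x y} xs → (P x → P y) →
                         length (filter P? (x ∷ xs)) ≤ length (filter P? (y ∷ xs))
  length-filter-∷-mono {x} {y} xs Px⇒Py with P? x | P? y
  ... | yes Px | no ¬Py = ⊥-elim (¬Py (Px⇒Py Px))
  ... | yes _  | yes _  = ≤-refl
  ... | no _   | yes _  = n≤1+n _
  ... | no _   | no _   = ≤-refl

  Unique-⊆⇒length-filter≤ : ∀ {xs ys} → Unique xs → xs ⊆ ys →
                            length (filter P? xs) ≤ length (filter P? ys)
  Unique-⊆⇒length-filter≤ {xs} {ys} xs! xs⊆ys = Unique-⊆⇒length≤ (filter⁺ P? xs!) filter⊆
    where
    filter⊆ : filter P? xs ⊆ filter P? ys
    filter⊆ x∈ with x∈xs , Px ← ∈-filter⁻ P? {xs = xs} x∈ = ∈-filter⁺ P? (xs⊆ys x∈xs) Px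

applyUpTo-⊆-upTo : ∀ (f : ℕ → ℕ) {n} k → (∀ i → f i < n) → applyUpTo f k ⊆ upTo n
applyUpTo-⊆-upTo f k f<n x∈ with i , _ , refl ← applyUpTo⁻ f x∈ = ∈-upTo⁺ (f<n i)

zipWith-applyUpTo-suc : ∀ {A B : Set} (_∙_ : A → A → B) (f : ℕ → A) n →
  zipWith _∙_ (applyUpTo (f ∘ suc) n) (applyUpTo f (suc n)) ≡ applyUpTo (λ i → f (suc i) ∙ f i) n
zipWith-applyUpTo-suc _∙_ f zero    = refl
zipWith-applyUpTo-suc _∙_ f (suc n) = cong (f 1 ∙ f 0 ∷_) (zipWith-applyUpTo-suc _∙_ (f ∘ suc) n)

module Congruence (p : ℕ) .{{_ : NonZero p}} where

  infix 4 _≋_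
  record _≋_ (x y : ℕ) : Set where
    constructor mod-≡
    field %-≡ : x % p ≡ y % p
  open _≋_ public

  ≋-setoid : Setoid 0ℓ 0ℓ
  ≋-setoid = record
    { Carrier       = ℕ
    ; _≈_           = _≋_
    ; isEquivalence = record
      { refl  = mod-≡ refl
      ; sym   = λ (mod-≡ x≡y) → mod-≡ (sym x≡y)
      ; trans = λ (mod-≡ x≡y) (mod-≡ y≡z) → mod-≡ (trans x≡y y≡z)
      }
    }

  open Setoid ≋-setoid public using () renaming (refl to ≋-refl; sym to ≋-sym; trans to ≋-trans)

  module ≋-Reasoning = SetoidReasoning ≋-setoid

  %-≋ : ∀ x → x % p ≋ x
  %-≋ x = mod-≡ (m%n%n≡m%n x p)

  ≋⇒≡ : ∀ {x y} → x < p → y < p → x ≋ y → x ≡ y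
  ≋⇒≡ x<p y<p (mod-≡ x≡y) = trans (sym (m<n⇒m%n≡m x<p)) (trans x≡y (m<n⇒m%n≡m y<p))

  +-congˡ : ∀ a {b c} → b ≋ c → a + b ≋ a + c
  +-congˡ a {b} {c} (mod-≡ b≡c) = mod-≡ (trans (%-distribˡ-+ a b p)
    (trans (cong (λ t → (a % p + t) % p) b≡c) (sym (%-distribˡ-+ a c p))))

  +-congʳ : ∀ c {a b} → a ≋ b → a + c ≋ b + c
  +-congʳ c {a} {b} (mod-≡ a≡b) = mod-≡ (trans (%-distribˡ-+ a c p)
    (trans (cong (λ t → (t + c % p) % p) a≡b) (sym (%-distribˡ-+ b c p))))

  *-congˡ : ∀ a {b c} → b ≋ c → a * b ≋ a * c
  *-congˡ a {b} {c} (mod-≡ b≡c) = mod-≡ (trans (%-distribˡ-* a b p)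
    (trans (cong (λ t → (a % p * t) % p) b≡c) (sym (%-distribˡ-* a c p))))

  *-congʳ : ∀ c {a b} → a ≋ b → a * c ≋ b * c
  *-congʳ c {a} {b} (mod-≡ a≡b) = mod-≡ (trans (%-distribˡ-* a c p)
    (trans (cong (λ t → (t * (c % p)) % p) a≡b) (sym (%-distribˡ-* b c p))))

  ^-cong : ∀ k {a b} → a ≋ b → a ^ k ≋ b ^ k
  ^-cong zero    a≋b = ≋-refl
  ^-cong (suc k) {a} {b} a≋b = ≋-trans (*-congʳ (a ^ k) a≋b) (*-congˡ b (^-cong k a≋b))

  *-cancelˡ-≋ : ∀ u {v x y} → u * v ≋ 1 → u * x ≋ u * y → x ≋ y
  *-cancelˡ-≋ u {v} {x} {y} uv≋1 ux≋uy = begin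
    x              ≡⟨ *-identityˡ x ⟨
    1 * x          ≈⟨ *-congʳ x uv≋1 ⟨
    u * v * x      ≡⟨ v-out x ⟩
    v * (u * x)    ≈⟨ *-congˡ v ux≋uy ⟩
    v * (u * y)    ≡⟨ v-out y ⟨
    u * v * y      ≈⟨ *-congʳ y uv≋1 ⟩
    1 * y          ≡⟨ *-identityˡ y ⟩
    y              ∎
    where
    open ≋-Reasoning
    v-out : ∀ z → u * v * z ≡ v * (u * z)
    v-out z = trans (cong (_* z) (*-comm u v)) (*-assoc v u z)

  subMod-≋ : ∀ x y {z} → y ≤ p → z + y ≋ x → subMod p x y ≋ z
  subMod-≋ x y {z} y≤p z+y≋x = begin
    subMod p x y         ≈⟨ %-≋ (x + (p ∸ y)) ⟩
    x + (p ∸ y)          ≈⟨ +-congʳ (p ∸ y) z+y≋x ⟨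
    z + y + (p ∸ y)      ≡⟨ trans (+-assoc z y (p ∸ y)) (cong (z +_) (m+[n∸m]≡n y≤p)) ⟩
    z + p                ≈⟨ mod-≡ ([m+n]%n≡m%n z p) ⟩
    z                    ∎
    where open ≋-Reasoning

module Rotation (p : ℕ) .{{_ : NonZero p}} (r e : ℕ) (r^[1+e]%≡1% : (r ^ suc e) % p ≡ 1 % p) (e<p : e < p) where

  open Congruence p

  r^[1+e]≋1 : r ^ suc e ≋ 1
  r^[1+e]≋1 = mod-≡ r^[1+e]%≡1%

  α : ℕ → ℕ
  α x = (r * x) % p

  iter-α : ∀ k x → iter α k x ≋ r ^ k * x
  iter-α zero    x = mod-≡ (cong (_% p) (sym (*-identityˡ x)))
  iter-α (suc k) x = begin
    iter α (suc k) x      ≈⟨ %-≋ (r * iter α k x) ⟩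
    r * iter α k x        ≈⟨ *-congˡ r (iter-α k x) ⟩
    r * (r ^ k * x)       ≡⟨ *-assoc r (r ^ k) x ⟨
    r ^ suc k * x         ∎
    where open ≋-Reasoning

  iter-α-period : ∀ x → iter α (suc e) x ≋ x
  iter-α-period x = begin
    iter α (suc e) x   ≈⟨ iter-α (suc e) x ⟩
    r ^ suc e * x      ≈⟨ *-congʳ x r^[1+e]≋1 ⟩
    1 * x              ≡⟨ *-identityˡ x ⟩
    x                  ∎
    where open ≋-Reasoning

  α-cancel : ∀ {x y} → α x ≡ α y → x ≋ y
  α-cancel αx≡αy = *-cancelˡ-≋ r r^[1+e]≋1 (mod-≡ αx≡αy)

  InCycle-α⁻¹ : ∀ {h w} → w < p → InCycle p α h (α w) → InCycle p α h w
  InCycle-α⁻¹ {h} {w} w<p αw∈ḣ with applyUpTo⁻ id αw∈ḣ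
  ... | suc s , 1+s<p , αw≡ =
    applyUpTo⁺ {P = λ s → w ≡ iter α (suc s) h} id
      (≋⇒≡ w<p (m%n<n _ p) (α-cancel αw≡)) (<-trans (n<1+n s) 1+s<p)
  ... | zero  , _     , αw≡ =
    applyUpTo⁺ {P = λ s → w ≡ iter α (suc s) h} id
      (≋⇒≡ w<p (m%n<n _ p) (≋-trans (α-cancel αw≡) (≋-sym (iter-α-period h)))) e<p

module PrimitiveRootPowers (m ρ : ℕ) (prim : PrimitiveRoot (suc (suc m)) ρ) where

  p n : ℕ
  p = suc (suc m)
  n = suc m

  open Congruence p

  unit≉0 : ∀ u {v} → u * v ≋ 1 → ¬ (u ≋ 0)
  -- Since p = 2 + m, the equation 1 % p ≡ 0 % p computes to 1 ≡ 0.
  unit≉0 u {v} uv≋1 u≋0 with () ← %-≡ (≋-trans (≋-sym uv≋1) (*-congʳ v u≋0))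

  ρ^n≋1 : ρ ^ n ≋ 1
  ρ^n≋1 = mod-≡ (proj₁ prim)

  ^n≋1 : ∀ k → (ρ ^ k) ^ n ≋ 1
  ^n≋1 k = begin
    (ρ ^ k) ^ n   ≡⟨ trans (^-*-assoc ρ k n) (trans (cong (ρ ^_) (*-comm k n)) (sym (^-*-assoc ρ n k))) ⟩
    (ρ ^ n) ^ k   ≈⟨ ^-cong k ρ^n≋1 ⟩
    1 ^ k         ≡⟨ ^-zeroˡ k ⟩
    1             ∎
    where open ≋-Reasoning

  ρ^≉0 : ∀ k → ¬ (ρ ^ k ≋ 0)
  ρ^≉0 k = unit≉0 (ρ ^ k) (^n≋1 k)

  ρ^-injective : ∀ {i j} → i < j → j < n → ¬ (ρ ^ i ≋ ρ ^ j)
  ρ^-injective {i} {j} i<j j<n ρ^i≋ρ^j =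
    proj₂ prim (j ∸ i) (m<n⇒0<n∸m i<j) (≤-<-trans (m∸n≤m j i) j<n) (%-≡ ρ^[j∸i]≋1)
    where
    open ≋-Reasoning
    ρ^[j∸i]≋1 : ρ ^ (j ∸ i) ≋ 1
    ρ^[j∸i]≋1 = *-cancelˡ-≋ (ρ ^ i) (^n≋1 i) (begin
      ρ ^ i * ρ ^ (j ∸ i)   ≡⟨ ^-distribˡ-+-* ρ i (j ∸ i) ⟨
      ρ ^ (i + (j ∸ i))     ≡⟨ cong (ρ ^_) (m+[n∸m]≡n (<⇒≤ i<j)) ⟩
      ρ ^ j                 ≈⟨ ρ^i≋ρ^j ⟨
      ρ ^ i                 ≡⟨ *-identityʳ (ρ ^ i) ⟨
      ρ ^ i * 1             ∎)

  Unique-geometric : ∀ c {v} → c * v ≋ 1 → (f : ℕ → ℕ) → (∀ i → f i ≋ c * ρ ^ i) → Unique (applyUpTo f n)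
  Unique-geometric c cv≋1 f f≋ = applyUpTo⁺₁ f n λ {i} {j} i<j j<n fi≡fj →
    ρ^-injective i<j j<n (*-cancelˡ-≋ c cv≋1 (≋-trans (≋-sym (f≋ i)) (≋-trans (mod-≡ (cong (_% p) fi≡fj)) (f≋ j))))

module PrimitiveRootConstruction (m ρ : ℕ) (prim : PrimitiveRoot (suc (suc m)) ρ)
    (r : ℕ) (r<p : r < suc (suc m)) (r[ρ∸1]%≡ρ% : (r * (ρ ∸ 1)) % suc (suc m) ≡ ρ % suc (suc m)) where

  open PrimitiveRootPowers m ρ prim
  open Congruence p

  r[ρ∸1]≋ρ : r * (ρ ∸ 1) ≋ ρ
  r[ρ∸1]≋ρ = mod-≡ r[ρ∸1]%≡ρ%

  ρ≢0 : ρ ≢ 0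
  ρ≢0 ρ≡0 = unit≉0 ρ ρ^n≋1 (mod-≡ (cong (_% p) ρ≡0))

  [ρ∸1]*q+q≡ρ*q : ∀ q → (ρ ∸ 1) * q + q ≡ ρ * q
  [ρ∸1]*q+q≡ρ*q q = trans (+-comm _ q) (cong (_* q) (suc-pred ρ {{≢-nonZero ρ≢0}}))

  ρ∸1-unit : (ρ ∸ 1) * (r * ρ ^ m) ≋ 1
  ρ∸1-unit = begin
    (ρ ∸ 1) * (r * ρ ^ m)   ≡⟨ trans (sym (*-assoc (ρ ∸ 1) r _)) (cong (_* ρ ^ m) (*-comm (ρ ∸ 1) r)) ⟩
    r * (ρ ∸ 1) * ρ ^ m     ≈⟨ *-congʳ (ρ ^ m) r[ρ∸1]≋ρ ⟩
    ρ * ρ ^ m               ≈⟨ ρ^n≋1 ⟩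
    1                       ∎
    where open ≋-Reasoning

  power : ℕ → ℕ
  power i = (ρ ^ suc i) % p

  primRootSeq≡ : primRootSeq p ρ ≡ 0 ∷ applyUpTo power n
  primRootSeq≡ = cong (0 ∷_) (map-upTo power n)

  arrangement : IsArrangement p (0 ∷ applyUpTo power n)
  arrangement = Unique-⊆-length≤⇒↭ (0∉powers ∷ Unique-geometric ρ ρ^n≋1 power (λ i → %-≋ (ρ ^ suc i)))
    ⊆upTo (≤-reflexive (trans (length-upTo p) (cong suc (sym (length-applyUpTo power n)))))
    where
    0∉powers : All (0 ≢_) (applyUpTo power n)
    0∉powers = All.applyUpTo⁺₂ power n λ i 0≡power → ρ^≉0 (suc i) (mod-≡ (sym 0≡power))
    ⊆upTo : 0 ∷ applyUpTo power n ⊆ upTo p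
    ⊆upTo (here refl) = ∈-upTo⁺ (s≤s z≤n)
    ⊆upTo (there x∈)  = applyUpTo-⊆-upTo power n (λ i → m%n<n (ρ ^ suc i) p) x∈

  nonzero⇒^n≋1 : ∀ {x} → x ∈ 0 ∷ applyUpTo power n → x ≢ 0 → x ^ n ≋ 1
  nonzero⇒^n≋1 (here x≡0) x≢0 = ⊥-elim (x≢0 x≡0)
  nonzero⇒^n≋1 {x} (there x∈) _ with i , _ , x≡ ← applyUpTo⁻ power x∈ =
    ≋-trans (^-cong n {x} (≋-trans (mod-≡ (cong (_% p) x≡)) (%-≋ (ρ ^ suc i)))) (^n≋1 (suc i))

  r≢0 : r ≢ 0
  r≢0 r≡0 = unit≉0 ρ ρ^n≋1 (≋-trans (≋-sym r[ρ∸1]≋ρ) (mod-≡ (cong (λ t → (t * (ρ ∸ 1)) % p) r≡0)))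

  r^n≋1 : r ^ n ≋ 1
  r^n≋1 = nonzero⇒^n≋1 (∈-resp-↭ (↭-sym arrangement) (∈-upTo⁺ r<p)) r≢0

  open Rotation p r m (%-≡ r^n≋1) (s≤s (n≤1+n m))

  -- T₁ with its first entry ρ = α (ρ - 1) replaced by ρ - 1.
  δ : ℕ → ℕ
  δ zero    = (ρ ∸ 1) % p
  δ (suc i) = subMod p (power (suc i)) (power i)

  δ<p : ∀ i → δ i < p
  δ<p zero    = m%n<n (ρ ∸ 1) p
  δ<p (suc i) = m%n<n (power (suc i) + (p ∸ power i)) p

  δ≋ : ∀ i → δ i ≋ (ρ ∸ 1) * ρ ^ i
  δ≋ zero    = ≋-trans (%-≋ (ρ ∸ 1)) (mod-≡ (cong (_% p) (sym (*-identityʳ (ρ ∸ 1)))))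
  δ≋ (suc i) = subMod-≋ (power (suc i)) (power i) (<⇒≤ (m%n<n (ρ ^ suc i) p)) (begin
    (ρ ∸ 1) * ρ ^ suc i + power i       ≈⟨ +-congˡ ((ρ ∸ 1) * ρ ^ suc i) (%-≋ (ρ ^ suc i)) ⟩
    (ρ ∸ 1) * ρ ^ suc i + ρ ^ suc i     ≡⟨ [ρ∸1]*q+q≡ρ*q (ρ ^ suc i) ⟩
    ρ ^ suc (suc i)                     ≈⟨ %-≋ (ρ ^ suc (suc i)) ⟨
    power (suc i)                       ∎)
    where open ≋-Reasoning

  firstDifference≡α[ρ∸1] : subMod p (power 0) 0 ≡ α (δ 0)
  firstDifference≡α[ρ∸1] = ≋⇒≡ (m%n<n (power 0 + p) p) (m%n<n (r * δ 0) p) (begin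
    subMod p (power 0) 0   ≈⟨ subMod-≋ (power 0) 0 z≤n (≋-trans (mod-≡ (cong (_% p) (+-identityʳ (ρ ^ 1)))) (≋-sym (%-≋ (ρ ^ 1)))) ⟩
    ρ ^ 1                  ≡⟨ *-identityʳ ρ ⟩
    ρ                      ≈⟨ r[ρ∸1]≋ρ ⟨
    r * (ρ ∸ 1)            ≈⟨ *-congˡ r (%-≋ (ρ ∸ 1)) ⟨
    r * δ 0                ≈⟨ %-≋ (r * δ 0) ⟨
    α (δ 0)                ∎)
    where open ≋-Reasoning

  diffLine≡ : diffLine p (0 ∷ applyUpTo power n) 1 ≡ subMod p (power 0) 0 ∷ applyUpTo (δ ∘ suc) m
  diffLine≡ = cong (subMod p (power 0) 0 ∷_) (zipWith-applyUpTo-suc (subMod p) power m)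

  T₁-count : ∀ h → length (filter (inCycle? p α h) (diffLine p (0 ∷ applyUpTo power n) 1)) ≤ length (cycle p α h)
  T₁-count h = subst (λ l → length (filter ∈ḣ? l) ≤ length (cycle p α h)) (sym diffLine≡) (≤-trans
    (length-filter-∷-mono ∈ḣ? _ λ first∈ḣ →
      InCycle-α⁻¹ (δ<p 0) (subst (InCycle p α h) firstDifference≡α[ρ∸1] first∈ḣ))
    (Unique-⊆⇒length-filter≤ ∈ḣ? (Unique-geometric (ρ ∸ 1) ρ∸1-unit δ δ≋) (applyUpTo-⊆-upTo δ n δ<p)))
    where
    ∈ḣ? : Decidable (InCycle p α h)
    ∈ḣ? = inCycle? p α h

  romanPseudoterrace : RomanPseudoterrace p α (primRootSeq p ρ)
  romanPseudoterrace = subst (RomanPseudoterrace p α) (sym primRootSeq≡) (arrangement , line₁-bound)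
    where
    line₁-bound : ∀ h → h < p → h ≢ 0 → ∀ j → 1 ≤ j → j ≤ 1 →
      length (filter (inCycle? p α h) (diffLine p (0 ∷ applyUpTo power n) j)) ≤ length (cycle p α h)
    line₁-bound h _ _ .1 (s≤s z≤n) (s≤s z≤n) = T₁-count h

theorem8 : (p : ℕ) .{{_ : NonZero p}} → Prime p → ¬ (p ≡ 2) →
           (ρ : ℕ) → PrimitiveRoot p ρ →
           (r : ℕ) → r < p → (r * (ρ ∸ 1)) % p ≡ ρ % p →
           RomanPseudoterrace p (λ x → (r * x) % p) (primRootSeq p ρ)
theorem8 (suc (suc m)) _  _ ρ prim r r<p r[ρ∸1]%≡ρ% =
  PrimitiveRootConstruction.romanPseudoterrace m ρ prim r r<p r[ρ∸1]%≡ρ%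
theorem8 0 pr _ _ _ _ _ _ with () ← nonTrivial⇒n>1 0 {{prime⇒nonTrivial pr}}
theorem8 1 pr _ _ _ _ _ _ with s≤s () ← nonTrivial⇒n>1 1 {{prime⇒nonTrivial pr}}
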